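{- Let $\phi=(\psi\to(\Box\chi\vee\xi))$ be a d-persistent formula of the unimodal language in which the propositional variable $p$ does not occur. Then the conditional formula $\phi^p$ is $\kappa_\emptyset$-persistent: for every conditional Esakia space $\mathbb X$ on which $\phi^p$ is valid, $\phi^p$ is valid on the empty fill-in $\kappa_\emptyset(\mathbb X)$.
   Context: Modal language: $\phi::=p\mid\bot\mid\phi\wedge\phi\mid\phi\vee\phi\mid\phi\to\phi\mid\Box\phi$; conditional language: the same with $\phi>\phi$ in place of $\Box\phi$. For a variable $p$, the translation $(\cdot)^p$ fixes variables, $\top,\bot$, commutes with $\wedge,\vee,\to$, and sends $(\Box\psi)^p=p>\psi^p$. An Esakia space is $(X,\le,\tau)$ with $(X,\le)$ a nonempty poset, $\tau$ compact, such that if $x\not\le y$ some clopen upset contains $x$ but not $y$, and ${\downarrow}a$ is clopen for clopen $a$. A modal Esakia space is $(X,\le,R,\tau)$ with $(X,\le,\tau)$ an Esakia space, $R[x]=\{y:xRy\}$ closed for all $x$, and $R=({\le}\circ R\circ{\le})$. A modal frame is $(X,\le,R)$ with $(X,\le)$ a preorder and whenever $x\le yRz$ there is $w$ with $xRw\le z$. Modal formulas are evaluated with intuitionistic Kripke clauses and $x\models\Box\phi$ iff all $R$-successors satisfy $\phi$; validity on a modal Esakia space uses valuations into clopen upsets, on a modal frame all upset valuations. A modal formula $\phi$ is d-persistent if for every modal Esakia space on which $\phi$ is valid, $\phi$ is valid on the underlying modal frame $(X,\le,R)$. A conditional Esakia space $\mathbb X=(X,\le,\tau,\mathcal R)$ is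 an Esakia space with relations $\{R_a: a\text{ clopen upset}\}$ such that $\{x:R_a[x]\subseteq b\}$ is clopen for clopen upsets $a,b$, $({\le}\circ R_a\circ{\le})=R_a$, and each $R_a[x]$ is closed; validity uses valuations into clopen upsets. A conditional Kripke frame has relations $R_a$ for all upsets $a$ with $x\le yR_az$ implying $xR_aw\le z$ for some $w$; validity uses all upset valuations. Conditionals: $x\models\phi>\psi$ iff every $y$ with $xR_{V(\phi)}y$ satisfies $\psi$. The empty fill-in $\kappa_\emptyset(\mathbb X)=(X,\le,\mathcal R')$ has $R'_a=R_a$ for clopen upsets $a$ and $R'_a=\emptyset$ for non-clopen upsets $a$. -}

module Defs where

open import Data.Nat using (ℕ)
open import Data.Product using (Σ; _×_; _,_)
open import Data.Sum using (_⊎_)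
open import Data.Empty using (⊥)
open import Data.Unit using (⊤)
open import Data.List using (List)
open import Data.List.Membership.Propositional using (_∈_)
open import Relation.Nullary using (¬_)
open import Relation.Binary.PropositionalEquality using (_≡_)

Subset : Set → Set₁
Subset X = X → Set

Rel : Set → Set₁
Rel X = X → X → Set

_⊆_ : {X : Set} → Subset X → Subset X → Set
a ⊆ b = ∀ x → a x → b x

_≐_ : {X : Set} → Subset X → Subset X → Set
a ≐ b = (a ⊆ b) × (b ⊆ a)

∁ : {X : Set} → Subset X → Subset X
∁ a x = ¬ a x

record Topology (X : Set) : Set₁ where
  field
    Open      : Subset X → Set
    open-ext  : ∀ {a b} → a ≐ b → Open a → Open b
    open-univ : Open (λ _ → ⊤)
    open-∩    : ∀ {a b} → Open a → Open b → Open (λ x → a x × b x)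
    open-⋃    : (I : Set) (U : I → Subset X) → (∀ i → Open (U i)) →
                Open (λ x → Σ I (λ i → U i x))

  Closed : Subset X → Set
  Closed a = Open (∁ a)

  Clopen : Subset X → Set
  Clopen a = Open a × Closed a

  Compact : Set₁
  Compact = (I : Set) (U : I → Subset X) → (∀ i → Open (U i)) →
            (∀ x → Σ I (λ i → U i x)) →
            Σ (List I) (λ is → ∀ x → Σ I (λ i → (i ∈ is) × U i x))

UpSet : {X : Set} → Rel X → Subset X → Set
UpSet _≤_ a = ∀ x y → x ≤ y → a x → a y

↓ : {X : Set} → Rel X → Subset X → Subset X
↓ _≤_ a y = Σ _ (λ x → y ≤ x × a x)

≤∘_∘≤ : {X : Set} → Rel X → Rel X → Rel X
≤∘_∘≤ _≤_ R x y = Σ _ (λ x' → Σ _ (λ y' → x ≤ x' × R x' y' × y' ≤ y))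

_≡ᴿ_ : {X : Set} → Rel X → Rel X → Set
R ≡ᴿ S = (∀ x y → R x y → S x y) × (∀ x y → S x y → R x y)

record EsakiaSpace : Set₁ where
  field
    Carrier   : Set
    _≤_       : Rel Carrier
    ≤-refl    : ∀ x → x ≤ x
    ≤-trans   : ∀ x y z → x ≤ y → y ≤ z → x ≤ z
    ≤-antisym : ∀ x y → x ≤ y → y ≤ x → x ≡ y
    nonempty  : Carrier
    τ         : Topology Carrier
  open Topology τ public
  ClopenUp : Subset Carrier → Set
  ClopenUp a = Clopen a × UpSet _≤_ a
  field
    compact   : Compact
    separation : ∀ x y → ¬ (x ≤ y) →
                 Σ (Subset Carrier) (λ U → ClopenUp U × U x × ¬ U y)
    ↓-clopen  : ∀ a → Clopen a → Clopen (↓ _≤_ a)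

record ModalEsakiaSpace : Set₁ where
  field
    esakia : EsakiaSpace
  open EsakiaSpace esakia public
  field
    R        : Rel Carrier
    R-closed : ∀ x → Closed (R x)
    R-≤      : R ≡ᴿ (≤∘ _≤_ ∘≤ R)

-- R is given on all subsets, but only its values on clopen upsets are
-- constrained/used; R-ext says R a depends only on the set a.
record CondEsakiaSpace : Set₁ where
  field
    esakia : EsakiaSpace
  open EsakiaSpace esakia public
  field
    R        : Subset Carrier → Rel Carrier
    R-ext    : ∀ a b → ClopenUp a → a ≐ b → ∀ x y → R a x y → R b x y
    R-box    : ∀ a b → ClopenUp a → ClopenUp b →
               Clopen (λ x → R a x ⊆ b)
    R-≤      : ∀ a → ClopenUp a → R a ≡ᴿ (≤∘ _≤_ ∘≤ (R a))
    R-closed : ∀ a → ClopenUp a → ∀ x → Closed (R a x)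

infixr 5 _⇒ₘ_
infixr 6 _∨ₘ_
infixr 7 _∧ₘ_

data MFm : Set where
  varₘ  : ℕ → MFm
  ⊥ₘ    : MFm
  _∧ₘ_  : MFm → MFm → MFm
  _∨ₘ_  : MFm → MFm → MFm
  _⇒ₘ_  : MFm → MFm → MFm
  □_    : MFm → MFm

module _ {X : Set} (_≤_ : Rel X) (R : Rel X) (V : ℕ → Subset X) where
  _⊨ₘ_ : X → MFm → Set
  x ⊨ₘ varₘ n  = V n x
  x ⊨ₘ ⊥ₘ      = ⊥
  x ⊨ₘ (φ ∧ₘ ψ) = (x ⊨ₘ φ) × (x ⊨ₘ ψ)
  x ⊨ₘ (φ ∨ₘ ψ) = (x ⊨ₘ φ) ⊎ (x ⊨ₘ ψ)
  x ⊨ₘ (φ ⇒ₘ ψ) = ∀ y → x ≤ y → y ⊨ₘ φ → y ⊨ₘ ψ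
  x ⊨ₘ (□ φ)    = ∀ y → R x y → y ⊨ₘ φ

ValidModalSpace : ModalEsakiaSpace → MFm → Set₁
ValidModalSpace M φ =
  (V : ℕ → Subset Carrier) → (∀ n → ClopenUp (V n)) →
  ∀ x → _⊨ₘ_ _≤_ R V x φ
  where open ModalEsakiaSpace M

ValidModalFrame : ModalEsakiaSpace → MFm → Set₁
ValidModalFrame M φ =
  (V : ℕ → Subset Carrier) → (∀ n → UpSet _≤_ (V n)) →
  ∀ x → _⊨ₘ_ _≤_ R V x φ
  where open ModalEsakiaSpace M

DPersistent : MFm → Set₁
DPersistent φ = (M : ModalEsakiaSpace) → ValidModalSpace M φ → ValidModalFrame M φ

Occurs : ℕ → MFm → Set
Occurs p (varₘ n)  = n ≡ p
Occurs p ⊥ₘ        = ⊥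
Occurs p (φ ∧ₘ ψ)  = Occurs p φ ⊎ Occurs p ψ
Occurs p (φ ∨ₘ ψ)  = Occurs p φ ⊎ Occurs p ψ
Occurs p (φ ⇒ₘ ψ)  = Occurs p φ ⊎ Occurs p ψ
Occurs p (□ φ)     = Occurs p φ

infixr 5 _⇒_
infixr 6 _∨_
infixr 7 _∧_
infixr 4 _▷_

data CFm : Set where
  var  : ℕ → CFm
  ⊥ᶜ   : CFm
  _∧_  : CFm → CFm → CFm
  _∨_  : CFm → CFm → CFm
  _⇒_  : CFm → CFm → CFm
  _▷_  : CFm → CFm → CFm

module _ {X : Set} (_≤_ : Rel X) (R : Subset X → Rel X) (V : ℕ → Subset X) where
  _⊨_ : X → CFm → Set
  x ⊨ var n   = V n x
  x ⊨ ⊥ᶜ      = ⊥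
  x ⊨ (φ ∧ ψ) = (x ⊨ φ) × (x ⊨ ψ)
  x ⊨ (φ ∨ ψ) = (x ⊨ φ) ⊎ (x ⊨ ψ)
  x ⊨ (φ ⇒ ψ) = ∀ y → x ≤ y → y ⊨ φ → y ⊨ ψ
  x ⊨ (φ ▷ ψ) = ∀ y → R (λ z → z ⊨ φ) x y → y ⊨ ψ

tr : ℕ → MFm → CFm
tr p (varₘ n)  = var n
tr p ⊥ₘ        = ⊥ᶜ
tr p (φ ∧ₘ ψ)  = tr p φ ∧ tr p ψ
tr p (φ ∨ₘ ψ)  = tr p φ ∨ tr p ψ
tr p (φ ⇒ₘ ψ)  = tr p φ ⇒ tr p ψ
tr p (□ φ)     = var p ▷ tr p φ

ValidCondSpace : CondEsakiaSpace → CFm → Set₁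
ValidCondSpace 𝕏 φ =
  (V : ℕ → Subset Carrier) → (∀ n → ClopenUp (V n)) →
  ∀ x → _⊨_ _≤_ R V x φ
  where open CondEsakiaSpace 𝕏

record CondFrame : Set₁ where
  field
    Carrier : Set
    _≤_     : Rel Carrier
    R       : Subset Carrier → Rel Carrier

ValidCondFrame : CondFrame → CFm → Set₁
ValidCondFrame F φ =
  (V : ℕ → Subset Carrier) → (∀ n → UpSet _≤_ (V n)) →
  ∀ x → _⊨_ _≤_ R V x φ
  where open CondFrame F

κ∅ : CondEsakiaSpace → CondFrame
κ∅ 𝕏 = record
  { Carrier = Carrier
  ; _≤_     = _≤_
  ; R       = λ a x y → ClopenUp a × R a x y
  }
  where open CondEsakiaSpace 𝕏

module Submission where

-- If the valuation of p is a clopen upset a, then φ^p at p evaluated in κ∅(𝕏) is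
-- just φ evaluated in the modal Esakia space (X, ≤, R_a); validity of φ^p on 𝕏
-- gives validity of φ on that space, and d-persistence carries it to all upset
-- valuations. If the valuation of p is not a clopen upset, the empty fill-in makes
-- every p > χ^p true, so the consequent □χ ∨ ξ of φ holds after translation.

open import Defs
open import Level using (0ℓ; suc; lift; lower)
open import Data.Nat using (ℕ; _≟_)
open import Data.Product using (_,_; proj₁; proj₂)
open import Data.Sum using (inj₁; inj₂)
open import Data.Empty using (⊥-elim)
open import Relation.Nullary using (¬_; yes; no)
open import Relation.Nullary.Decidable using (map′)
open import Relation.Binary.PropositionalEquality using (_≡_; _≢_; refl; sym; subst)
open import Axiom.ExcludedMiddle using (ExcludedMiddle)

module Translation {X : Set} (_≤_ : Rel X) (Rₘ : Rel X) (Rᶜ : Subset X → Rel X)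
  (W V : ℕ → Subset X) (p : ℕ)
  (agree : ∀ n → n ≢ p → W n ≡ V n)
  (R-agree : Rᶜ (V p) ≡ᴿ Rₘ) where

  tr-sound    : ∀ θ → ¬ Occurs p θ → ∀ x → _⊨ₘ_ _≤_ Rₘ W x θ → _⊨_ _≤_ Rᶜ V x (tr p θ)
  tr-complete : ∀ θ → ¬ Occurs p θ → ∀ x → _⊨_ _≤_ Rᶜ V x (tr p θ) → _⊨ₘ_ _≤_ Rₘ W x θ

  tr-sound (varₘ n) p∉ x h = subst (λ a → a x) (agree n p∉) h
  tr-sound ⊥ₘ       p∉ x h = h
  tr-sound (θ ∧ₘ η) p∉ x (h , k) =
    tr-sound θ (λ o → p∉ (inj₁ o)) x h , tr-sound η (λ o → p∉ (inj₂ o)) x k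
  tr-sound (θ ∨ₘ η) p∉ x (inj₁ h) = inj₁ (tr-sound θ (λ o → p∉ (inj₁ o)) x h)
  tr-sound (θ ∨ₘ η) p∉ x (inj₂ h) = inj₂ (tr-sound η (λ o → p∉ (inj₂ o)) x h)
  tr-sound (θ ⇒ₘ η) p∉ x h y x≤y hθ =
    tr-sound η (λ o → p∉ (inj₂ o)) y (h y x≤y (tr-complete θ (λ o → p∉ (inj₁ o)) y hθ))
  tr-sound (□ θ)    p∉ x h y xRy = tr-sound θ p∉ y (h y (R-agree .proj₁ x y xRy))

  tr-complete (varₘ n) p∉ x h = subst (λ a → a x) (sym (agree n p∉)) h
  tr-complete ⊥ₘ       p∉ x h = h
  tr-complete (θ ∧ₘ η) p∉ x (h , k) =
    tr-complete θ (λ o → p∉ (inj₁ o)) x h , tr-complete η (λ o → p∉ (inj₂ o)) x k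
  tr-complete (θ ∨ₘ η) p∉ x (inj₁ h) = inj₁ (tr-complete θ (λ o → p∉ (inj₁ o)) x h)
  tr-complete (θ ∨ₘ η) p∉ x (inj₂ h) = inj₂ (tr-complete η (λ o → p∉ (inj₂ o)) x h)
  tr-complete (θ ⇒ₘ η) p∉ x h y x≤y hθ =
    tr-complete η (λ o → p∉ (inj₂ o)) y (h y x≤y (tr-sound θ (λ o → p∉ (inj₁ o)) y hθ))
  tr-complete (□ θ)    p∉ x h y xRy = tr-complete θ p∉ y (h y (R-agree .proj₂ x y xRy))

update : {X : Set} → (ℕ → Subset X) → ℕ → Subset X → ℕ → Subset X
update W p a n with n ≟ p
... | yes _ = a
... | no  _ = W n

update-at : {X : Set} (W : ℕ → Subset X) (p : ℕ) (a : Subset X) → update W p a p ≡ a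
update-at W p a with p ≟ p
... | yes _   = refl
... | no  p≢p = ⊥-elim (p≢p refl)

update-off : {X : Set} (W : ℕ → Subset X) (p : ℕ) (a : Subset X) →
             ∀ n → n ≢ p → W n ≡ update W p a n
update-off W p a n n≢p with n ≟ p
... | yes n≡p = ⊥-elim (n≢p n≡p)
... | no  _   = refl

update-preserves : {X : Set} (P : Subset X → Set) (W : ℕ → Subset X) (p : ℕ) (a : Subset X) →
                   (∀ n → P (W n)) → P a → ∀ n → P (update W p a n)
update-preserves P W p a PW Pa n with n ≟ p
... | yes _ = Pa
... | no  _ = PW n

module _ (𝕏 : CondEsakiaSpace) where
  open CondEsakiaSpace 𝕏

  modalAt : (a : Subset Carrier) → ClopenUp a → ModalEsakiaSpace
  modalAt a a-cu = record
    { esakia   = esakia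
    ; R        = R a
    ; R-closed = R-closed a a-cu
    ; R-≤      = R-≤ a a-cu
    }

  validCond⇒validModalAt : ∀ p φ → ¬ Occurs p φ → ValidCondSpace 𝕏 (tr p φ) →
                           ∀ a (a-cu : ClopenUp a) → ValidModalSpace (modalAt a a-cu) φ
  validCond⇒validModalAt p φ p∉ valid a a-cu W W-cu x =
    tr-complete φ p∉ x (valid W′ (update-preserves ClopenUp W p a W-cu a-cu) x)
    where
    W′ : ℕ → Subset Carrier
    W′ = update W p a

    R-W′p : R (W′ p) ≡ᴿ R a
    R-W′p = subst (λ b → R b ≡ᴿ R a) (sym (update-at W p a))
                  ((λ _ _ r → r) , (λ _ _ r → r))

    open Translation _≤_ (R a) R W W′ p (update-off W p a) R-W′p

  κ∅-⊨-tr-at-clopen : ∀ p φ → ¬ Occurs p φ → DPersistent φ → ValidCondSpace 𝕏 (tr p φ) →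
                      (V : ℕ → Subset Carrier) → (∀ n → UpSet _≤_ (V n)) → ClopenUp (V p) →
                      ∀ x → _⊨_ _≤_ (CondFrame.R (κ∅ 𝕏)) V x (tr p φ)
  κ∅-⊨-tr-at-clopen p φ p∉ dp valid V V-up Vp-cu x =
    tr-sound φ p∉ x (dp (modalAt (V p) Vp-cu) (validCond⇒validModalAt p φ p∉ valid (V p) Vp-cu) V V-up x)
    where
    open Translation _≤_ (R (V p)) (CondFrame.R (κ∅ 𝕏)) V V p (λ _ _ → refl)
      ((λ _ _ → proj₂) , (λ _ _ r → Vp-cu , r))

  κ∅-⊨-▷-at-nonclopen : (V : ℕ → Subset Carrier) (p : ℕ) → ¬ ClopenUp (V p) →
                        ∀ θ x → _⊨_ _≤_ (CondFrame.R (κ∅ 𝕏)) V x (var p ▷ θ)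
  κ∅-⊨-▷-at-nonclopen V p Vp-ncu θ x y (Vp-cu , _) = ⊥-elim (Vp-ncu Vp-cu)

theorem7p10 : ExcludedMiddle (suc 0ℓ) →
    (p : ℕ) (ψ χ ξ : MFm) →
    ¬ Occurs p (ψ ⇒ₘ (□ χ ∨ₘ ξ)) →
    DPersistent (ψ ⇒ₘ (□ χ ∨ₘ ξ)) →
    (𝕏 : CondEsakiaSpace) →
    ValidCondSpace 𝕏 (tr p (ψ ⇒ₘ (□ χ ∨ₘ ξ))) →
    ValidCondFrame (κ∅ 𝕏) (tr p (ψ ⇒ₘ (□ χ ∨ₘ ξ)))
theorem7p10 em p ψ χ ξ p∉ dp 𝕏 valid V V-up x
  with map′ lower lift em
... | yes Vp-cu = κ∅-⊨-tr-at-clopen 𝕏 p (ψ ⇒ₘ (□ χ ∨ₘ ξ)) p∉ dp valid V V-up Vp-cu x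
... | no  Vp-ncu = λ y _ _ → inj₁ (κ∅-⊨-▷-at-nonclopen 𝕏 V p Vp-ncu (tr p χ) y)
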